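{- Let $N$ be a binary matroid and $a \in E(N)$ an element that is neither a loop nor a coloop of $N$, such that $N \backslash a \cong M^*(K_{3,3})$. If $N/a$ has no minor isomorphic to $F_7$ or $F_7^*$, then $N/a$ is graphic.
   Context: $F_7$ is the Fano matroid, $F_7^*$ its dual, and $M^*(K_{3,3})$ is the dual of the cycle matroid of the complete bipartite graph $K_{3,3}$. -}

module Defs where

open import Data.Nat using (ℕ; zero; suc; _<_)
open import Data.Fin using (Fin; zero; suc)
open import Data.Bool using (Bool; true; false; if_then_else_; _xor_)
open import Data.Vec using (Vec; []; _∷_; replicate; zipWith; insertAt; lookup; tabulate)
open import Data.Fin.Subset using (Subset; inside; outside; ⊥; ⁅_⁆; _⊆_; _⊂_; _∈_; _∉_; _∩_; _∪_; ∣_∣; Nonempty)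
open import Data.Product using (Σ; ∃; _×_; _,_)
open import Data.Sum using (_⊎_)
open import Relation.Nullary using (¬_)
open import Relation.Binary.PropositionalEquality using (_≡_; _≢_)
open import Function.Bundles using (_⇔_; _↔_; Inverse)

IndepSys : ℕ → Set₁
IndepSys n = Subset n → Set

record IsMatroid {n : ℕ} (M : IndepSys n) : Set where
  field
    empty-indep : M ⊥
    hereditary  : ∀ X Y → Y ⊆ X → M X → M Y
    augment     : ∀ X Y → M X → M Y → ∣ X ∣ < ∣ Y ∣ →
                  ∃ λ e → e ∈ Y × e ∉ X × M (X ∪ ⁅ e ⁆)

IsBasis : ∀ {n} → IndepSys n → Subset n → Set
IsBasis M B = M B × (∀ Y → B ⊂ Y → ¬ M Y)

Loop : ∀ {n} → IndepSys n → Fin n → Set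
Loop M a = ¬ M ⁅ a ⁆

Coloop : ∀ {n} → IndepSys n → Fin n → Set
Coloop M a = ∀ B → IsBasis M B → a ∈ B

Dual : ∀ {n} → IndepSys n → IndepSys n
Dual M X = ∃ λ B → IsBasis M B × (X ∩ B ≡ ⊥)

-- deletion and contraction of element a (remaining ground set re-indexed
-- by Fin n via insertion at position a)
Delete : ∀ {n} → IndepSys (suc n) → Fin (suc n) → IndepSys n
Delete M a X = M (insertAt X a outside)

-- if a is a loop, M / a = M \ a; otherwise X is independent in M / a
-- iff X ∪ {a} is independent in M
Contract : ∀ {n} → IndepSys (suc n) → Fin (suc n) → IndepSys n
Contract M a X =
  (M ⁅ a ⁆ × M (insertAt X a inside)) ⊎ (¬ M ⁅ a ⁆ × M (insertAt X a outside))

pullback : ∀ {n m} → (Fin n ↔ Fin m) → Subset m → Subset n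
pullback σ Y = tabulate (λ i → lookup Y (Inverse.to σ i))

Iso : ∀ {n m} → IndepSys n → IndepSys m → Set
Iso {n} {m} M M' = Σ (Fin n ↔ Fin m) λ σ → ∀ Y → M' Y ⇔ M (pullback σ Y)

data Minor : ∀ {m n} → IndepSys m → IndepSys n → Set₁ where
  iso : ∀ {m n} {M : IndepSys m} {N : IndepSys n} → Iso N M → Minor M N
  del : ∀ {m n} {M : IndepSys m} {N : IndepSys (suc n)} (a : Fin (suc n)) →
        Minor M (Delete N a) → Minor M N
  con : ∀ {m n} {M : IndepSys m} {N : IndepSys (suc n)} (a : Fin (suc n)) →
        Minor M (Contract N a) → Minor M N

-- Binary matroids: independence = linear independence over GF(2) of
-- columns A e ∈ GF(2)^r (GF(2) = Bool, addition = xor).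

zeroV : ∀ {r} → Vec Bool r
zeroV = replicate _ false

_⊕_ : ∀ {r} → Vec Bool r → Vec Bool r → Vec Bool r
u ⊕ v = zipWith _xor_ u v

sumCols : ∀ {n r} → (Fin n → Vec Bool r) → Subset n → Vec Bool r
sumCols {zero}  A []      = zeroV
sumCols {suc n} A (b ∷ Y) =
  (if b then A zero else zeroV) ⊕ sumCols (λ i → A (suc i)) Y

LinIndep : ∀ {n r} → (Fin n → Vec Bool r) → IndepSys n
LinIndep A X = ∀ Y → Y ⊆ X → Nonempty Y → sumCols A Y ≢ zeroV

Binary : ∀ {n} → IndepSys n → Set
Binary {n} M = Σ ℕ λ r → Σ (Fin n → Vec Bool r) λ A → ∀ X → M X ⇔ LinIndep A X

-- Graphs and cycle matroids. A (multi)graph with V vertices and n edges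
-- is a map edges : Fin n → Fin V × Fin V (loops / parallel edges allowed).

-- cyclic successor on Fin (suc k)
next : ∀ {k} → Fin (suc k) → Fin (suc k)
next {zero}  zero    = zero
next {suc k} zero    = suc zero
next {suc k} (suc i) with next {k} i
... | zero  = zero
... | suc j = suc (suc j)

Joins : ∀ {V} → Fin V × Fin V → Fin V → Fin V → Set
Joins (u , w) x y = (u ≡ x × w ≡ y) ⊎ (u ≡ y × w ≡ x)

CycleIn : ∀ {V n} → (Fin n → Fin V × Fin V) → Subset n → Set
CycleIn {V} {n} edges X =
  Σ ℕ λ k → Σ (Fin (suc k) → Fin V) λ v → Σ (Fin (suc k) → Fin n) λ e →
    (∀ i j → v i ≡ v j → i ≡ j) × (∀ i j → e i ≡ e j → i ≡ j) ×
    (∀ i → Joins (edges (e i)) (v i) (v (next i))) × (∀ i → e i ∈ X)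

CycleMatroid : ∀ {V n} → (Fin n → Fin V × Fin V) → IndepSys n
CycleMatroid edges X = ¬ CycleIn edges X

Graphic : ∀ {n} → IndepSys n → Set
Graphic {n} M = Σ ℕ λ V → Σ (Fin n → Fin V × Fin V) λ edges →
  Iso (CycleMatroid edges) M

v0 : Fin 6
v0 = zero

v1 : Fin 6
v1 = (suc (zero))

v2 : Fin 6
v2 = (suc (suc (zero)))

v3 : Fin 6
v3 = (suc (suc (suc (zero))))

v4 : Fin 6
v4 = (suc (suc (suc (suc (zero)))))

v5 : Fin 6
v5 = (suc (suc (suc (suc (suc (zero))))))

K33edgeList : Vec (Fin 6 × Fin 6) 9
K33edgeList =
  (v0 , v3) ∷ (v0 , v4) ∷ (v0 , v5) ∷
  (v1 , v3) ∷ (v1 , v4) ∷ (v1 , v5) ∷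
  (v2 , v3) ∷ (v2 , v4) ∷ (v2 , v5) ∷ []

K33 : Fin 9 → Fin 6 × Fin 6
K33 e = lookup K33edgeList e

MK33* : IndepSys 9
MK33* = Dual (CycleMatroid K33)

fanoCols : Vec (Vec Bool 3) 7
fanoCols =
  (true ∷ false ∷ false ∷ []) ∷ (false ∷ true ∷ false ∷ []) ∷
  (false ∷ false ∷ true ∷ []) ∷ (true ∷ true ∷ false ∷ []) ∷
  (true ∷ false ∷ true ∷ []) ∷ (false ∷ true ∷ true ∷ []) ∷
  (true ∷ true ∷ true ∷ []) ∷ []

F7 : IndepSys 7
F7 = LinIndep (lookup fanoCols)

F7* : IndepSys 7
F7* = Dual F7

-- N \ a ≅ M*(K₃,₃) has rank 4 and a is neither a loop nor a coloop, so in a binary representation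
-- of N the column of a is a nonzero combination v of the columns of N \ a. A representation of
-- M*(K₃,₃) is determined by its values on a basis through the fundamental circuits, so N is
-- represented by the standard 4 × 9 matrix of M*(K₃,₃) together with the column v, and contracting
-- a amounts to projecting GF(2)⁴ onto GF(2)⁴/⟨v⟩ ≅ GF(2)³. For each of the fifteen choices of v the
-- nine projected columns miss a point of the Fano plane PG(2,2), and PG(2,2) minus a point is M(K₄). The finitely many facts about M*(K₃,₃) and its quotients are decided by
-- evaluating decision procedures on explicit certificates (spanning trees and cycles).

module Submission where

open import Defs
open import Algebra.Bundles using (AbelianGroup)
open import Algebra.Structures using (IsAbelianGroup)
import Algebra.Properties.CommutativeMonoid.Sum as MonoidSum
import Algebra.Properties.CommutativeSemigroup as CommSemigroupProps
import Algebra.Properties.Group as GroupProps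
open import Data.Bool using (Bool; true; false; _xor_; if_then_else_)
open import Data.Bool.Properties
  using (xor-assoc; xor-comm; xor-identityˡ; xor-identityʳ; xor-same) renaming (_≟_ to _≟ᵇ_)
open import Data.Empty using (⊥; ⊥-elim)
open import Data.Fin using (Fin; zero; suc; punchIn; punchOut; inject₁; fromℕ; #_)
open import Data.Fin.Properties
  using (punchIn-punchOut; suc-injective) renaming (any? to anyFin?; all? to allFin?; _≟_ to _≟ᶠ_)
open import Data.Fin.Subset using (Subset; inside; outside; ⁅_⁆; ⊤; _∈_; _∉_; _⊆_; _⊂_; _∩_; _∪_; Nonempty)
import Data.Fin.Subset as Subset
open import Data.Fin.Subset.Properties
  using (drop-∷-⊆; out⊆; in⊆in; ⊆⊤; ⊆-refl; ⊆-antisym; Empty-unique; x∈⁅x⁆; x∈⁅y⁆⇒x≡y; x∈p∪q⁻; p⊆p∪q; q⊆p∪q;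
         x∈p∩q⁺; ∉⊥; nonempty?; _∈?_; _⊆?_; anySubset?)
open import Data.Nat using (ℕ; zero; suc)
open import Data.List using (List; []; _∷_; [_]; map; concatMap; filter; cartesianProductWith; allFin)
open import Data.List.Relation.Unary.All using (All; all?; lookupAny)
open import Data.List.Relation.Unary.All.Properties using (all-filter)
open import Data.List.Relation.Unary.Any using (Any; any?)
open import Data.Product using (Σ; ∃; _×_; _,_; proj₁; uncurry)
open import Data.Sum using (_⊎_; inj₁; inj₂; [_,_]′; map₂)
open import Data.Vec using (Vec; []; _∷_; lookup; tabulate; insertAt; removeAt; here)
open import Data.Vec.Properties
  using (zipWith-assoc; zipWith-comm; zipWith-identityˡ; zipWith-identityʳ; lookup∘tabulate;
         insertAt-lookup; insertAt-punchIn; insertAt-removeAt; []=⇒lookup; lookup⇒[]=; ≡-dec; tabulate-cong;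
         tabulate∘lookup; lookup-zipWith; lookup-replicate)
open import Function using (_∘_; id; _↔_; _⇔_; Inverse; Equivalence; mk⇔; case_of_)
open import Function.Construct.Symmetry using (↔-sym)
open import Function.Construct.Composition using (_↔-∘_)
open import Function.Construct.Identity using (↔-id)
open import Function.Properties.Equivalence using (⇔-setoid)
import Relation.Binary.Reasoning.Setoid as SetoidReasoning
open import Level using (0ℓ)
open import Relation.Binary.PropositionalEquality
  using (_≡_; _≢_; refl; sym; trans; cong; cong₂; subst; isEquivalence; module ≡-Reasoning)
open import Relation.Nullary using (¬_; Dec; yes; no; contradiction)
import Relation.Nullary.Decidable as Dec
open import Relation.Nullary.Decidable using (_×-dec_; _⊎-dec_; _→-dec_; ¬?; from-yes)
open import Relation.Unary using (Pred; Decidable)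

private variable
  k m n r : ℕ

module ⇔-Reasoning = SetoidReasoning (⇔-setoid 0ℓ)

⊕-self : (u : Vec Bool r) → u ⊕ u ≡ zeroV
⊕-self []      = refl
⊕-self (x ∷ u) = cong₂ _∷_ (xor-same x) (⊕-self u)

⊕-isAbelianGroup : IsAbelianGroup _≡_ (_⊕_ {r}) zeroV id
⊕-isAbelianGroup = record
  { isGroup = record
    { isMonoid = record
      { isSemigroup = record
        { isMagma = record { isEquivalence = isEquivalence ; ∙-cong = cong₂ _⊕_ }
        ; assoc = zipWith-assoc xor-assoc }
      ; identity = zipWith-identityˡ xor-identityˡ , zipWith-identityʳ xor-identityʳ }
    ; inverse = ⊕-self , ⊕-self
    ; ⁻¹-cong = id }
  ; comm = zipWith-comm xor-comm }

⊕-abelianGroup : ℕ → AbelianGroup 0ℓ 0ℓ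
⊕-abelianGroup r = record { isAbelianGroup = ⊕-isAbelianGroup {r} }

module _ {r : ℕ} where
  open AbelianGroup (⊕-abelianGroup r) public
    using () renaming (comm to ⊕-comm; identityˡ to ⊕-identityˡ; identityʳ to ⊕-identityʳ)
  open CommSemigroupProps (AbelianGroup.commutativeSemigroup (⊕-abelianGroup r)) public
    using () renaming (interchange to ⊕-interchange; x∙yz≈y∙xz to ⊕-exchange)
  open GroupProps (AbelianGroup.group (⊕-abelianGroup r)) public
    using () renaming (x∙y⁻¹≈ε⇒x≈y to ⊕≡zero⇒≡)

open module ∑ {r} = MonoidSum (AbelianGroup.commutativeMonoid (⊕-abelianGroup r))
  using (sum; sum-cong-≗; ∑-distrib-+; sum-init-last; sum-permute)

infixr 30 _·_

_·_ : Bool → Vec Bool r → Vec Bool r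
b · u = if b then u else zeroV

·-distribʳ-xor : ∀ x y (u : Vec Bool r) → (x xor y) · u ≡ x · u ⊕ y · u
·-distribʳ-xor false y u = sym (⊕-identityˡ _)
·-distribʳ-xor true false u = sym (⊕-identityʳ u)
·-distribʳ-xor true true u = sym (⊕-self u)

sumCols≡sum : (A : Fin n → Vec Bool r) (X : Subset n) → sumCols A X ≡ sum (λ i → lookup X i · A i)
sumCols≡sum {zero}  A []      = refl
sumCols≡sum {suc n} A (b ∷ X) = cong (b · A zero ⊕_) (sumCols≡sum (A ∘ suc) X)

sumCols-cong : {A B : Fin n → Vec Bool r} → (∀ i → A i ≡ B i) → ∀ X → sumCols A X ≡ sumCols B X
sumCols-cong {A = A} {B} A≗B X = begin
  sumCols A X                      ≡⟨ sumCols≡sum A X ⟩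
  sum (λ i → lookup X i · A i)     ≡⟨ sum-cong-≗ (λ i → cong (lookup X i ·_) (A≗B i)) ⟩
  sum (λ i → lookup X i · B i)     ≡⟨ sumCols≡sum B X ⟨
  sumCols B X                      ∎
  where open ≡-Reasoning

sumCols-⊥ : (A : Fin n → Vec Bool r) → sumCols A Subset.⊥ ≡ zeroV
sumCols-⊥ {zero}  A = refl
sumCols-⊥ {suc n} A = trans (⊕-identityˡ _) (sumCols-⊥ (A ∘ suc))

sumCols-⊕ : (A : Fin n → Vec Bool r) (X Y : Subset n) → sumCols A (X ⊕ Y) ≡ sumCols A X ⊕ sumCols A Y
sumCols-⊕ {zero}  A []      []      = sym (⊕-identityˡ _)
sumCols-⊕ {suc n} A (x ∷ X) (y ∷ Y) = begin
  (x xor y) · A zero ⊕ sumCols (A ∘ suc) (X ⊕ Y)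
    ≡⟨ cong₂ _⊕_ (·-distribʳ-xor x y (A zero)) (sumCols-⊕ (A ∘ suc) X Y) ⟩
  (x · A zero ⊕ y · A zero) ⊕ (sumCols (A ∘ suc) X ⊕ sumCols (A ∘ suc) Y)
    ≡⟨ ⊕-interchange _ _ _ _ ⟩
  (x · A zero ⊕ sumCols (A ∘ suc) X) ⊕ (y · A zero ⊕ sumCols (A ∘ suc) Y) ∎
  where open ≡-Reasoning

sumCols-⁅⁆ : (A : Fin n → Vec Bool r) (i : Fin n) → sumCols A ⁅ i ⁆ ≡ A i
sumCols-⁅⁆ {suc n} A zero    = trans (cong (A zero ⊕_) (sumCols-⊥ (A ∘ suc))) (⊕-identityʳ _)
sumCols-⁅⁆ {suc n} A (suc i) = trans (⊕-identityˡ _) (sumCols-⁅⁆ (A ∘ suc) i)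

sumCols-· : (A : Fin n → Vec Bool r) (b : Bool) (X : Subset n) → sumCols A (b · X) ≡ b · sumCols A X
sumCols-· A false X = sumCols-⊥ A
sumCols-· A true  X = refl

-- sumCols M u is the product of the matrix with columns M and the vector u
sumCols-sumCols : (M : Fin r → Vec Bool m) (A : Fin n → Vec Bool r) (X : Subset n) →
                  sumCols M (sumCols A X) ≡ sumCols (sumCols M ∘ A) X
sumCols-sumCols {n = zero}  M A []      = sumCols-⊥ M
sumCols-sumCols {n = suc n} M A (b ∷ X) =
  trans (sumCols-⊕ M (b · A zero) _) (cong₂ _⊕_ (sumCols-· M b (A zero)) (sumCols-sumCols M (A ∘ suc) X))

sumCols-insertAt : (A : Fin (suc n) → Vec Bool r) (X : Subset n) (a : Fin (suc n)) (b : Bool) →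
                   sumCols A (insertAt X a b) ≡ b · A a ⊕ sumCols (A ∘ punchIn a) X
sumCols-insertAt A X       zero    b = refl
sumCols-insertAt A (x ∷ X) (suc a) b = begin
  x · A zero ⊕ sumCols (A ∘ suc) (insertAt X a b)
    ≡⟨ cong (x · A zero ⊕_) (sumCols-insertAt (A ∘ suc) X a b) ⟩
  x · A zero ⊕ (b · A (suc a) ⊕ sumCols (A ∘ suc ∘ punchIn a) X)
    ≡⟨ ⊕-exchange _ _ _ ⟩
  b · A (suc a) ⊕ (x · A zero ⊕ sumCols (A ∘ suc ∘ punchIn a) X) ∎
  where open ≡-Reasoning

sumCols-pullback : (A : Fin n → Vec Bool r) (σ : Fin n ↔ Fin m) (Y : Subset m) →
                   sumCols A (pullback σ Y) ≡ sumCols (A ∘ Inverse.from σ) Y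
sumCols-pullback A σ Y = begin
  sumCols A (pullback σ Y)                                ≡⟨ sumCols≡sum A (pullback σ Y) ⟩
  sum (λ i → lookup (pullback σ Y) i · A i)               ≡⟨ sum-permute _ (↔-sym σ) ⟩
  sum (λ j → lookup (pullback σ Y) (from j) · A (from j))
    ≡⟨ sum-cong-≗ (λ j → cong (_· A (from j)) (lookup-pullback j)) ⟩
  sum (λ j → lookup Y j · A (from j))                     ≡⟨ sumCols≡sum (A ∘ from) Y ⟨
  sumCols (A ∘ from) Y                                    ∎
  where
  open ≡-Reasoning
  open Inverse σ
  lookup-pullback : ∀ j → lookup (pullback σ Y) (from j) ≡ lookup Y j
  lookup-pullback j = trans (lookup∘tabulate _ (from j)) (cong (lookup Y) (strictlyInverseˡ j))

data PunchInView (a : Fin (suc n)) : Fin (suc n) → Set where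
  at      : PunchInView a a
  punched : ∀ i → PunchInView a (punchIn a i)

punchInView : (a x : Fin (suc n)) → PunchInView a x
punchInView a x with a ≟ᶠ x
... | yes refl = at
... | no a≢x   = subst (PunchInView a) (punchIn-punchOut a≢x) (punched (punchOut a≢x))

data InsertAtView (a : Fin (suc n)) : Subset (suc n) → Set where
  insertAt-view : ∀ Z b → InsertAtView a (insertAt Z a b)

insertAtView : (a : Fin (suc n)) (W : Subset (suc n)) → InsertAtView a W
insertAtView a W = subst (InsertAtView a) (insertAt-removeAt W a) (insertAt-view (removeAt W a) (lookup W a))

module _ {Z : Subset n} {a : Fin (suc n)} where

  ∈-insertAt-at⁻ : ∀ {b} → a ∈ insertAt Z a b → b ≡ true
  ∈-insertAt-at⁻ {b} a∈ = trans (sym (insertAt-lookup Z a b)) ([]=⇒lookup a∈)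

  ∈-insertAt-at⁺ : a ∈ insertAt Z a true
  ∈-insertAt-at⁺ = lookup⇒[]= a _ (insertAt-lookup Z a true)

  ∈-insertAt-punchIn⁻ : ∀ {b i} → punchIn a i ∈ insertAt Z a b → i ∈ Z
  ∈-insertAt-punchIn⁻ {b} {i} p = lookup⇒[]= i Z (trans (sym (insertAt-punchIn Z a b i)) ([]=⇒lookup p))

  ∈-insertAt-punchIn⁺ : ∀ {b i} → i ∈ Z → punchIn a i ∈ insertAt Z a b
  ∈-insertAt-punchIn⁺ {b} {i} p = lookup⇒[]= (punchIn a i) _ (trans (insertAt-punchIn Z a b i) ([]=⇒lookup p))

  insertAt-Nonempty⁺ : ∀ {b} → Nonempty Z → Nonempty (insertAt Z a b)
  insertAt-Nonempty⁺ (i , i∈Z) = punchIn a i , ∈-insertAt-punchIn⁺ i∈Z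

  insertAt-Nonempty⁻ : ∀ {b} → Nonempty (insertAt Z a b) → Nonempty Z ⊎ b ≡ true
  insertAt-Nonempty⁻ (x , x∈) with punchInView a x
  ... | at        = inj₂ (∈-insertAt-at⁻ x∈)
  ... | punched i = inj₁ (i , ∈-insertAt-punchIn⁻ x∈)

module _ {Z X : Subset n} {a : Fin (suc n)} where

  insertAt-⊆ : ∀ {b b′} → Z ⊆ X → (b ≡ true → b′ ≡ true) → insertAt Z a b ⊆ insertAt X a b′
  insertAt-⊆ Z⊆X b⇒b′ {x} x∈ with punchInView a x
  ... | at        = lookup⇒[]= a _ (trans (insertAt-lookup X a _) (b⇒b′ (∈-insertAt-at⁻ x∈)))
  ... | punched i = ∈-insertAt-punchIn⁺ (Z⊆X (∈-insertAt-punchIn⁻ x∈))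

  insertAt-⊆⁻ : ∀ {b b′} → insertAt Z a b ⊆ insertAt X a b′ → Z ⊆ X
  insertAt-⊆⁻ W⊆ i∈Z = ∈-insertAt-punchIn⁻ (W⊆ (∈-insertAt-punchIn⁺ i∈Z))

  insertAt-⊆-at : ∀ {b b′} → insertAt Z a b ⊆ insertAt X a b′ → b ≡ true → b′ ≡ true
  insertAt-⊆-at W⊆ refl = ∈-insertAt-at⁻ (W⊆ ∈-insertAt-at⁺)

-- enumerates only the subsets of X, which keeps the certificate checks below fast
allSubsetsOf? : {P : Pred (Subset n) 0ℓ} (X : Subset n) → Decidable P → Dec (∀ Z → Z ⊆ X → P Z)
allSubsetsOf? [] P? = Dec.map′ (λ { p [] _ → p }) (λ h → h [] ⊆-refl) (P? [])
allSubsetsOf? {P = P} (false ∷ X) P? = Dec.map′ extend restrict (allSubsetsOf? X (P? ∘ (false ∷_)))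
  where
  extend : (∀ Z → Z ⊆ X → P (false ∷ Z)) → ∀ Z → Z ⊆ false ∷ X → P Z
  extend h (false ∷ Z) Z⊆ = h Z (drop-∷-⊆ Z⊆)
  extend h (true ∷ Z)  Z⊆ = contradiction (Z⊆ here) λ ()
  restrict : (∀ Z → Z ⊆ false ∷ X → P Z) → ∀ Z → Z ⊆ X → P (false ∷ Z)
  restrict h Z Z⊆X = h (false ∷ Z) (out⊆ Z⊆X)
allSubsetsOf? {P = P} (true ∷ X) P? =
  Dec.map′ extend restrict (allSubsetsOf? X (P? ∘ (false ∷_)) ×-dec allSubsetsOf? X (P? ∘ (true ∷_)))
  where
  extend : (∀ Z → Z ⊆ X → P (false ∷ Z)) × (∀ Z → Z ⊆ X → P (true ∷ Z)) → ∀ Z → Z ⊆ true ∷ X → P Z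
  extend (h , _) (false ∷ Z) Z⊆ = h Z (drop-∷-⊆ Z⊆)
  extend (_ , h) (true ∷ Z)  Z⊆ = h Z (drop-∷-⊆ Z⊆)
  restrict : (∀ Z → Z ⊆ true ∷ X → P Z) → (∀ Z → Z ⊆ X → P (false ∷ Z)) × (∀ Z → Z ⊆ X → P (true ∷ Z))
  restrict h = (λ Z Z⊆X → h (false ∷ Z) (out⊆ Z⊆X)) , (λ Z Z⊆X → h (true ∷ Z) (in⊆in Z⊆X))

allSubsets? : {P : Pred (Subset n) 0ℓ} → Decidable P → Dec (∀ Z → P Z)
allSubsets? {P = P} P? = Dec.map′ (λ h Z → h Z ⊆⊤) restrict (allSubsetsOf? ⊤ P?)
  where
  restrict : (∀ Z → P Z) → ∀ Z → Z ⊆ ⊤ → P Z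
  restrict h Z _ = h Z

infix 4 _≟ᵛ_

_≟ᵛ_ : (u w : Vec Bool r) → Dec (u ≡ w)
_≟ᵛ_ = ≡-dec _≟ᵇ_

module _ {A : Fin n → Vec Bool r} where

  linIndep? : Decidable (LinIndep A)
  linIndep? X = allSubsetsOf? X λ Z → nonempty? Z →-dec ¬? (sumCols A Z ≟ᵛ zeroV)

  ¬LinIndep⇒dependent : ∀ {X} → ¬ LinIndep A X → ∃ λ Z → Z ⊆ X × Nonempty Z × sumCols A Z ≡ zeroV
  ¬LinIndep⇒dependent {X} dep with anySubset? (λ Z → Z ⊆? X ×-dec nonempty? Z ×-dec sumCols A Z ≟ᵛ zeroV)
  ... | yes found = found
  ... | no ¬found = ⊥-elim (dep λ Z Z⊆X Z≢∅ ΣZ≡0 → ¬found (Z , Z⊆X , Z≢∅ , ΣZ≡0))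

LinIndep-cong : {A B : Fin n → Vec Bool r} → (∀ i → A i ≡ B i) → ∀ X → LinIndep A X ⇔ LinIndep B X
LinIndep-cong A≗B X = mk⇔
  (λ indep Z Z⊆X Z≢∅ ΣZ≡0 → indep Z Z⊆X Z≢∅ (trans (sumCols-cong A≗B Z) ΣZ≡0))
  (λ indep Z Z⊆X Z≢∅ ΣZ≡0 → indep Z Z⊆X Z≢∅ (trans (sumCols-cong (sym ∘ A≗B) Z) ΣZ≡0))

LinIndep-sumCols⁻ : (M : Fin r → Vec Bool m) (A : Fin n → Vec Bool r) {X : Subset n} →
                    LinIndep (sumCols M ∘ A) X → LinIndep A X
LinIndep-sumCols⁻ M A indep Z Z⊆X Z≢∅ ΣZ≡0 = indep Z Z⊆X Z≢∅ (begin
  sumCols (sumCols M ∘ A) Z ≡⟨ sumCols-sumCols M A Z ⟨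
  sumCols M (sumCols A Z)   ≡⟨ cong (sumCols M) ΣZ≡0 ⟩
  sumCols M zeroV           ≡⟨ sumCols-⊥ M ⟩
  zeroV                     ∎)
  where open ≡-Reasoning

LinIndep-sumCols : (M : Fin r → Vec Bool m) → (∀ u → sumCols M u ≡ zeroV → u ≡ zeroV) →
                   (A : Fin n → Vec Bool r) (X : Subset n) → LinIndep (sumCols M ∘ A) X ⇔ LinIndep A X
LinIndep-sumCols M M-injective A X = mk⇔ (LinIndep-sumCols⁻ M A)
  (λ indep Z Z⊆X Z≢∅ ΣZ≡0 → indep Z Z⊆X Z≢∅ (M-injective _ (trans (sumCols-sumCols M A Z) ΣZ≡0)))

∈-pullback : (σ : Fin n ↔ Fin m) {Y : Subset m} {i : Fin n} → i ∈ pullback σ Y ⇔ Inverse.to σ i ∈ Y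
∈-pullback σ {Y} {i} = mk⇔
  (λ i∈ → lookup⇒[]= _ Y (trans (sym (lookup∘tabulate _ i)) ([]=⇒lookup i∈)))
  (λ i∈ → lookup⇒[]= i _ (trans (lookup∘tabulate _ i) ([]=⇒lookup i∈)))

LinIndep-pullback : (A : Fin n → Vec Bool r) (σ : Fin n ↔ Fin m) (Y : Subset m) →
                    LinIndep A (pullback σ Y) ⇔ LinIndep (A ∘ Inverse.from σ) Y
LinIndep-pullback A σ Y = mk⇔
  (λ indep Z Z⊆Y Z≢∅ ΣZ≡0 → indep (pullback σ Z)
      (λ i∈ → ∈σ.from (Z⊆Y (∈σ.to i∈)))
      (let (j , j∈Z) = Z≢∅ in from j , ∈σ.from (subst (_∈ Z) (sym (strictlyInverseˡ j)) j∈Z))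
      (trans (sumCols-pullback A σ Z) ΣZ≡0))
  (λ indep W W⊆ W≢∅ ΣW≡0 → indep (pullback (↔-sym σ) W)
      (λ j∈ → subst (_∈ Y) (strictlyInverseˡ _) (∈σ.to (W⊆ (∈σ⁻¹.to j∈))))
      (let (i , i∈W) = W≢∅ in to i , ∈σ⁻¹.from (subst (_∈ W) (sym (strictlyInverseʳ i)) i∈W))
      (trans (sumCols-pullback (A ∘ from) (↔-sym σ) W)
             (trans (sumCols-cong (λ i → cong A (strictlyInverseʳ i)) W) ΣW≡0)))
  where
  open Inverse σ
  module ∈σ {Z} {i} = Equivalence (∈-pullback σ {Z} {i})
  module ∈σ⁻¹ {Z} {i} = Equivalence (∈-pullback (↔-sym σ) {Z} {i})

module _ (A : Fin (suc n) → Vec Bool r) (a : Fin (suc n)) where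

  private
    A′ : Fin n → Vec Bool r
    A′ = A ∘ punchIn a

  LinIndep-insertAt-outside : ∀ X → LinIndep A (insertAt X a false) ⇔ LinIndep A′ X
  LinIndep-insertAt-outside X = mk⇔
    (λ indep Z Z⊆X Z≢∅ ΣZ≡0 → indep (insertAt Z a false) (insertAt-⊆ Z⊆X id) (insertAt-Nonempty⁺ Z≢∅)
      (trans (sumCols-insertAt A Z a false) (trans (⊕-identityˡ _) ΣZ≡0)))
    reduce
    where
    reduce : LinIndep A′ X → LinIndep A (insertAt X a false)
    reduce indep W W⊆ W≢∅ ΣW≡0 with insertAtView a W
    ... | insertAt-view Z true  = contradiction (insertAt-⊆-at W⊆ refl) λ ()
    ... | insertAt-view Z false = indep Z (insertAt-⊆⁻ W⊆) ([ id , (λ ()) ]′ (insertAt-Nonempty⁻ W≢∅))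
      (trans (sym (trans (sumCols-insertAt A Z a false) (⊕-identityˡ _))) ΣW≡0)

  LinIndep-insertAt-outsideSpan : (∀ Z → sumCols A′ Z ≢ A a) →
                                  ∀ X → LinIndep A (insertAt X a false) → LinIndep A (insertAt X a true)
  LinIndep-insertAt-outsideSpan A-a∉span X indep W W⊆ W≢∅ ΣW≡0 with insertAtView a W
  ... | insertAt-view Z false = indep _ (insertAt-⊆ (insertAt-⊆⁻ W⊆) id) W≢∅ ΣW≡0
  ... | insertAt-view Z true  =
    A-a∉span Z (sym (⊕≡zero⇒≡ (A a) _ (trans (sym (sumCols-insertAt A Z a true)) ΣW≡0)))

  LinIndep-insertAt-inside : (M : Fin r → Vec Bool m) → A a ≢ zeroV → sumCols M (A a) ≡ zeroV →
    (∀ u → sumCols M u ≡ zeroV → u ≡ zeroV ⊎ u ≡ A a) →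
    ∀ X → LinIndep A (insertAt X a true) ⇔ LinIndep (sumCols M ∘ A′) X
  LinIndep-insertAt-inside M A-a≢0 M-kills-A-a kernel X = mk⇔ project unproject
    where
    kills : ∀ b → sumCols M (b · A a) ≡ zeroV
    kills false = sumCols-⊥ M
    kills true  = M-kills-A-a

    project : LinIndep A (insertAt X a true) → LinIndep (sumCols M ∘ A′) X
    project indep Z Z⊆X Z≢∅ ΣZ≡0 =
      [ dependent-with-a outside , dependent-with-a inside ]′ (kernel _ (trans (sumCols-sumCols M A′ Z) ΣZ≡0))
      where
      dependent-with-a : ∀ b → sumCols A′ Z ≡ b · A a → ⊥
      dependent-with-a b ΣZ≡bA-a = indep (insertAt Z a b) (insertAt-⊆ Z⊆X (λ _ → refl)) (insertAt-Nonempty⁺ Z≢∅) (begin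
        sumCols A (insertAt Z a b) ≡⟨ sumCols-insertAt A Z a b ⟩
        b · A a ⊕ sumCols A′ Z     ≡⟨ cong (b · A a ⊕_) ΣZ≡bA-a ⟩
        b · A a ⊕ b · A a          ≡⟨ ⊕-self _ ⟩
        zeroV                      ∎)
        where open ≡-Reasoning

    unproject : LinIndep (sumCols M ∘ A′) X → LinIndep A (insertAt X a true)
    unproject indep W W⊆ W≢∅ ΣW≡0 with insertAtView a W
    ... | insertAt-view Z b with nonempty? Z
    ...   | yes Z≢∅ = indep Z (insertAt-⊆⁻ W⊆) Z≢∅ (begin
      sumCols (sumCols M ∘ A′) Z ≡⟨ sumCols-sumCols M A′ Z ⟨
      sumCols M (sumCols A′ Z)   ≡⟨ cong (sumCols M) ΣZ≡bA-a ⟩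
      sumCols M (b · A a)        ≡⟨ kills b ⟩
      zeroV                      ∎)
      where
      open ≡-Reasoning
      ΣZ≡bA-a : sumCols A′ Z ≡ b · A a
      ΣZ≡bA-a = sym (⊕≡zero⇒≡ _ _ (trans (sym (sumCols-insertAt A Z a b)) ΣW≡0))
    ...   | no Z≡∅ with insertAt-Nonempty⁻ W≢∅
    ...     | inj₁ Z≢∅ = Z≡∅ Z≢∅
    ...     | inj₂ refl = A-a≢0 (begin
      A a                                ≡⟨ ⊕-identityʳ _ ⟨
      A a ⊕ zeroV                        ≡⟨ cong (A a ⊕_) (sumCols-⊥ A′) ⟨
      A a ⊕ sumCols A′ Subset.⊥          ≡⟨ cong (λ Z → A a ⊕ sumCols A′ Z) (Empty-unique Z≡∅) ⟨
      A a ⊕ sumCols A′ Z                 ≡⟨ sumCols-insertAt A Z a true ⟨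
      sumCols A (insertAt Z a true)      ≡⟨ ΣW≡0 ⟩
      zeroV                              ∎)
      where open ≡-Reasoning

IsCircuit : IndepSys n → Subset n → Set
IsCircuit M D = ¬ M D × (∀ Z → Z ⊂ D → M Z)

circuit-sumCols : (A : Fin n → Vec Bool r) {D : Subset n} → IsCircuit (LinIndep A) D → sumCols A D ≡ zeroV
circuit-sumCols A {D} (dependent , minimal) with ¬LinIndep⇒dependent dependent
... | Z , Z⊆D , Z≢∅ , ΣZ≡0 with anyFin? (λ x → x ∈? D ×-dec ¬? (x ∈? Z))
...   | yes (x , x∈D , x∉Z) = contradiction ΣZ≡0 (minimal Z (Z⊆D , x , x∈D , x∉Z) Z ⊆-refl Z≢∅)
...   | no ∄x = subst (λ D → sumCols A D ≡ zeroV) (⊆-antisym Z⊆D D⊆Z) ΣZ≡0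
  where
  D⊆Z : D ⊆ Z
  D⊆Z {x} x∈D with x ∈? Z
  ... | yes x∈Z = x∈Z
  ... | no x∉Z  = ⊥-elim (∄x (x , x∈D , x∉Z))

IsCircuit-cong : {M M′ : IndepSys n} → (∀ X → M X ⇔ M′ X) → ∀ {D} → IsCircuit M D → IsCircuit M′ D
IsCircuit-cong M⇔M′ (dependent , minimal) =
  dependent ∘ Equivalence.from (M⇔M′ _) , λ Z Z⊂D → Equivalence.to (M⇔M′ Z) (minimal Z Z⊂D)

module _ {N : IndepSys (suc n)} {A : Fin (suc n) → Vec Bool r}
         (represents : ∀ X → N X ⇔ LinIndep A X) (a : Fin (suc n)) where

  nonloop-column≢0 : ¬ Loop N a → A a ≢ zeroV
  nonloop-column≢0 ¬loop A-a≡0 = ¬loop λ N-a →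
    Equivalence.to (represents ⁅ a ⁆) N-a ⁅ a ⁆ ⊆-refl (a , x∈⁅x⁆ a) (trans (sumCols-⁅⁆ A a) A-a≡0)

  noncoloop-column∈span : ¬ Coloop N a → ∃ λ Z → sumCols (A ∘ punchIn a) Z ≡ A a
  noncoloop-column∈span ¬coloop with anySubset? (λ Z → sumCols (A ∘ punchIn a) Z ≟ᵛ A a)
  ... | yes inSpan = inSpan
  ... | no ∉span   = ⊥-elim (¬coloop every-basis-contains-a)
    where
    every-basis-contains-a : Coloop N a
    every-basis-contains-a B (indep , maximal) with insertAtView a B
    ... | insertAt-view X true  = ∈-insertAt-at⁺
    ... | insertAt-view X false = ⊥-elim (maximal (insertAt X a true)
      (insertAt-⊆ ⊆-refl (λ _ → refl) , a , ∈-insertAt-at⁺ , λ a∈ → contradiction (∈-insertAt-at⁻ a∈) λ ())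
      (Equivalence.from (represents _)
        (LinIndep-insertAt-outsideSpan A a (λ Z ΣZ≡A-a → ∉span (Z , ΣZ≡A-a)) X
          (Equivalence.to (represents _) indep))))

Contract-nonloop : {N : IndepSys (suc n)} → IsMatroid N → ∀ {a} → ¬ Loop N a →
                   ∀ X → Contract N a X ⇔ N (insertAt X a true)
Contract-nonloop matroid {a} ¬loop X = mk⇔
  (λ { (inj₁ (_ , indep)) → indep ; (inj₂ (loop , _)) → contradiction loop ¬loop })
  (λ indep → inj₁ (IsMatroid.hereditary matroid _ _ ⁅a⁆⊆ indep , indep))
  where
  ⁅a⁆⊆ : ⁅ a ⁆ ⊆ insertAt X a true
  ⁅a⁆⊆ x∈ = subst (_∈ insertAt X a true) (sym (x∈⁅y⁆⇒x≡y a x∈)) ∈-insertAt-at⁺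

Iso-trans : {M₁ : IndepSys n} {M₂ : IndepSys m} {M₃ : IndepSys k} → Iso M₁ M₂ → Iso M₂ M₃ → Iso M₁ M₃
Iso-trans {M₁ = M₁} {M₂} {M₃} (σ , M₁≅M₂) (τ , M₂≅M₃) = τ ↔-∘ σ , λ Y → begin
  M₃ Y                              ≈⟨ M₂≅M₃ Y ⟩
  M₂ (pullback τ Y)                 ≈⟨ M₁≅M₂ (pullback τ Y) ⟩
  M₁ (pullback σ (pullback τ Y))    ≡⟨ cong M₁ (tabulate-cong λ i → lookup∘tabulate _ (Inverse.to σ i)) ⟩
  M₁ (pullback (τ ↔-∘ σ) Y)         ∎
  where open ⇔-Reasoning

CycleIn-pullback : ∀ {V} (G : Fin n → Fin V × Fin V) (σ : Fin n ↔ Fin m) (Y : Subset m) →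
                   CycleIn G (pullback σ Y) ⇔ CycleIn (G ∘ Inverse.from σ) Y
CycleIn-pullback G σ Y = mk⇔
  (λ (k , v , e , v-inj , e-inj , joins , e∈) →
     k , v , to ∘ e , v-inj , (λ i j → e-inj i j ∘ to-injective) ,
     (λ i → subst (λ x → Joins (G x) (v i) (v (next i))) (sym (strictlyInverseʳ (e i))) (joins i)) ,
     (λ i → Equivalence.to (∈-pullback σ) (e∈ i)))
  (λ (k , v , e , v-inj , e-inj , joins , e∈) →
     k , v , from ∘ e , v-inj , (λ i j → e-inj i j ∘ from-injective) , joins ,
     (λ i → Equivalence.from (∈-pullback σ) (subst (_∈ Y) (sym (strictlyInverseˡ (e i))) (e∈ i))))
  where
  open Inverse σ
  to-injective : ∀ {i j} → to i ≡ to j → i ≡ j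
  to-injective {i} {j} eq = trans (sym (strictlyInverseʳ i)) (trans (cong from eq) (strictlyInverseʳ j))
  from-injective : ∀ {i j} → from i ≡ from j → i ≡ j
  from-injective {i} {j} eq = trans (sym (strictlyInverseˡ i)) (trans (cong to eq) (strictlyInverseˡ j))

Graphic-Iso : {M : IndepSys n} {M′ : IndepSys m} → Iso M M′ → Graphic M → Graphic M′
Graphic-Iso {M = M} {M′} M≅M′ (V , G , cycles≅M) with Iso-trans {M₁ = CycleMatroid G} {M₂ = M} cycles≅M M≅M′
... | σ , cycles≅M′ = V , G ∘ Inverse.from σ , ↔-id _ , λ Y → begin
  M′ Y                                           ≈⟨ cycles≅M′ Y ⟩
  CycleMatroid G (pullback σ Y)                  ≈⟨ ¬-cong (CycleIn-pullback G σ Y) ⟩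
  CycleMatroid (G ∘ Inverse.from σ) Y            ≡⟨ cong (CycleMatroid (G ∘ Inverse.from σ)) (tabulate∘lookup Y) ⟨
  CycleMatroid (G ∘ Inverse.from σ) (pullback (↔-id _) Y) ∎
  where
  open ⇔-Reasoning
  ¬-cong : ∀ {P Q : Set} → P ⇔ Q → (¬ P) ⇔ (¬ Q)
  ¬-cong P⇔Q = mk⇔ (λ ¬p q → ¬p (Equivalence.from P⇔Q q)) (λ ¬q p → ¬q (Equivalence.to P⇔Q p))

incidence : ∀ {V} → Fin V × Fin V → Vec Bool V
incidence (u , w) = ⁅ u ⁆ ⊕ ⁅ w ⁆

Joins⇒incidence : ∀ {V} {p : Fin V × Fin V} {x y} → Joins p x y → incidence p ≡ ⁅ x ⁆ ⊕ ⁅ y ⁆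
Joins⇒incidence (inj₁ (refl , refl)) = refl
Joins⇒incidence (inj₂ (refl , refl)) = ⊕-comm _ _

next-inject₁ : (i : Fin k) → next (inject₁ i) ≡ suc i
next-inject₁ {suc k} zero    = refl
next-inject₁ {suc k} (suc i) rewrite next-inject₁ i = refl

next-fromℕ : ∀ k → next (fromℕ k) ≡ zero
next-fromℕ zero    = refl
next-fromℕ (suc k) rewrite next-fromℕ k = refl

sum-next : (f : Fin (suc k) → Vec Bool r) → sum (f ∘ next) ≡ sum f
sum-next {k} f = begin
  sum (f ∘ next)                                ≡⟨ sum-init-last (f ∘ next) ⟩
  sum (f ∘ next ∘ inject₁) ⊕ f (next (fromℕ k))
    ≡⟨ cong₂ _⊕_ (sum-cong-≗ (cong f ∘ next-inject₁)) (cong f (next-fromℕ k)) ⟩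
  sum (f ∘ suc) ⊕ f zero                        ≡⟨ ⊕-comm _ _ ⟩
  sum f                                         ∎
  where open ≡-Reasoning

sumCols-sum : (A : Fin n → Vec Bool r) (F : Fin k → Subset n) → sumCols A (sum F) ≡ sum (sumCols A ∘ F)
sumCols-sum {k = zero}  A F = sumCols-⊥ A
sumCols-sum {k = suc k} A F = trans (sumCols-⊕ A (F zero) _) (cong (sumCols A (F zero) ⊕_) (sumCols-sum A (F ∘ suc)))

-- the ⊕-sum of the singletons, which is the image of e when e is injective
edgeSet : (Fin k → Fin m) → Subset m
edgeSet e = sum (⁅_⁆ ∘ e)

module _ {m : ℕ} where

  private
    lookup-⊕ : (u w : Subset m) (x : Fin m) → lookup (u ⊕ w) x ≡ lookup u x xor lookup w x
    lookup-⊕ u w x = lookup-zipWith _xor_ x u w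

    lookup-⁅⁆-≢ : {x y : Fin m} → y ≢ x → lookup ⁅ y ⁆ x ≡ false
    lookup-⁅⁆-≢ {x} {y} y≢x with lookup ⁅ y ⁆ x in eq
    ... | false = refl
    ... | true  = contradiction (sym (x∈⁅y⁆⇒x≡y y (lookup⇒[]= x _ eq))) y≢x

  edgeSet-∌ : (e : Fin k → Fin m) {x : Fin m} → (∀ i → e i ≢ x) → lookup (edgeSet e) x ≡ false
  edgeSet-∌ {zero}  e {x} e≢x = lookup-replicate x false
  edgeSet-∌ {suc k} e {x} e≢x =
    trans (lookup-⊕ ⁅ e zero ⁆ _ x) (cong₂ _xor_ (lookup-⁅⁆-≢ (e≢x zero)) (edgeSet-∌ (e ∘ suc) (e≢x ∘ suc)))

  edgeSet-∋ : (e : Fin k → Fin m) → (∀ i j → e i ≡ e j → i ≡ j) → ∀ i → e i ∈ edgeSet e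
  edgeSet-∋ e e-inj i = lookup⇒[]= (e i) _ (lookup-edgeSet e e-inj i)
    where
    lookup-edgeSet : ∀ {k} (e : Fin k → Fin m) → (∀ i j → e i ≡ e j → i ≡ j) → ∀ i → lookup (edgeSet e) (e i) ≡ true
    lookup-edgeSet e e-inj zero = trans (lookup-⊕ ⁅ e zero ⁆ _ (e zero))
      (cong₂ _xor_ ([]=⇒lookup (x∈⁅x⁆ (e zero)))
                   (edgeSet-∌ (e ∘ suc) λ i eq → contradiction (e-inj (suc i) zero eq) λ ()))
    lookup-edgeSet e e-inj (suc i) = trans (lookup-⊕ ⁅ e zero ⁆ _ (e (suc i)))
      (cong₂ _xor_ (lookup-⁅⁆-≢ λ eq → contradiction (e-inj _ _ eq) λ ())
                   (lookup-edgeSet (e ∘ suc) (λ i j → suc-injective ∘ e-inj (suc i) (suc j)) i))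

  edgeSet-⊆ : (e : Fin k → Fin m) {X : Subset m} → (∀ i → e i ∈ X) → edgeSet e ⊆ X
  edgeSet-⊆ e e∈X {x} x∈ with anyFin? (λ i → e i ≟ᶠ x)
  ... | yes (i , refl) = e∈X i
  ... | no ∄i = contradiction (trans (sym ([]=⇒lookup x∈)) (edgeSet-∌ e λ i eq → ∄i (i , eq))) λ ()

cycle⇒¬LinIndep-incidence : ∀ {V} (G : Fin m → Fin V × Fin V) {X} → CycleIn G X → ¬ LinIndep (incidence ∘ G) X
cycle⇒¬LinIndep-incidence G (k , v , e , _ , e-inj , joins , e∈X) indep =
  indep (edgeSet e) (edgeSet-⊆ e e∈X) (e zero , edgeSet-∋ e e-inj zero) (begin
    sumCols (incidence ∘ G) (edgeSet e)          ≡⟨ sumCols-sum (incidence ∘ G) (⁅_⁆ ∘ e) ⟩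
    sum (λ i → sumCols (incidence ∘ G) ⁅ e i ⁆)
      ≡⟨ sum-cong-≗ (λ i → trans (sumCols-⁅⁆ (incidence ∘ G) (e i)) (Joins⇒incidence (joins i))) ⟩
    sum (λ i → ⁅ v i ⁆ ⊕ ⁅ v (next i) ⁆)         ≡⟨ ∑-distrib-+ (⁅_⁆ ∘ v) (⁅_⁆ ∘ v ∘ next) ⟩
    sum (⁅_⁆ ∘ v) ⊕ sum (⁅_⁆ ∘ v ∘ next)         ≡⟨ cong (sum (⁅_⁆ ∘ v) ⊕_) (sum-next (⁅_⁆ ∘ v)) ⟩
    sum (⁅_⁆ ∘ v) ⊕ sum (⁅_⁆ ∘ v)                ≡⟨ ⊕-self _ ⟩
    zeroV                                        ∎)
  where open ≡-Reasoning

CycleIn-mono : ∀ {V} (G : Fin m → Fin V × Fin V) {X Y} → X ⊆ Y → CycleIn G X → CycleIn G Y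
CycleIn-mono G X⊆Y (k , v , e , v-inj , e-inj , joins , e∈X) = k , v , e , v-inj , e-inj , joins , X⊆Y ∘ e∈X

Graphic-LinIndep : ∀ {V} (P : Fin m → Vec Bool r) (G : Fin m → Fin V × Fin V) (M : Fin V → Vec Bool r) →
                   (∀ x → sumCols M (incidence (G x)) ≡ P x) →
                   (∀ Z → Nonempty Z → sumCols P Z ≡ zeroV → CycleIn G Z) →
                   Graphic (LinIndep P)
Graphic-LinIndep P G M potential dependent⇒cycle = _ , G , ↔-id _ , λ Y → begin
  LinIndep P Y                            ≈⟨ mk⇔ acyclic independent ⟩
  CycleMatroid G Y                        ≡⟨ cong (CycleMatroid G) (tabulate∘lookup Y) ⟨
  CycleMatroid G (pullback (↔-id _) Y)    ∎
  where
  open ⇔-Reasoning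
  acyclic : ∀ {Y} → LinIndep P Y → CycleMatroid G Y
  acyclic indep cycle =
    cycle⇒¬LinIndep-incidence G cycle
      (LinIndep-sumCols⁻ M (incidence ∘ G) (Equivalence.from (LinIndep-cong potential _) indep))
  independent : ∀ {Y} → CycleMatroid G Y → LinIndep P Y
  independent acyclic Z Z⊆Y Z≢∅ ΣZ≡0 = acyclic (CycleIn-mono G Z⊆Y (dependent⇒cycle Z Z≢∅ ΣZ≡0))

data CycleCert (V m : ℕ) : Set where
  cycleCert : ∀ {k} → Vec (Fin V) (suc k) → Vec (Fin m) (suc k) → CycleCert V m

module _ {V : ℕ} (G : Fin m → Fin V × Fin V) where

  private
    Injective : ∀ {k} {A : Set} → (Fin k → A) → Set
    Injective f = ∀ i j → f i ≡ f j → i ≡ j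

    injective? : ∀ {k l} (f : Fin k → Fin l) → Dec (Injective f)
    injective? f = allFin? λ i → allFin? λ j → (f i ≟ᶠ f j) →-dec (i ≟ᶠ j)

    joins? : (p : Fin V × Fin V) (x y : Fin V) → Dec (Joins p x y)
    joins? (u , w) x y = ((u ≟ᶠ x) ×-dec (w ≟ᶠ y)) ⊎-dec ((u ≟ᶠ y) ×-dec (w ≟ᶠ x))

  IsCycleCert : CycleCert V m → Set
  IsCycleCert (cycleCert vs es) = Injective (lookup vs) × Injective (lookup es) ×
                                  (∀ i → Joins (G (lookup es i)) (lookup vs i) (lookup vs (next i)))

  isCycleCert? : Decidable IsCycleCert
  isCycleCert? (cycleCert vs es) = injective? (lookup vs) ×-dec injective? (lookup es) ×-dec
                                   allFin? (λ i → joins? (G (lookup es i)) (lookup vs i) (lookup vs (next i)))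

  CertIn : CycleCert V m → Subset m → Set
  CertIn (cycleCert vs es) X = ∀ i → lookup es i ∈ X

  certIn? : ∀ c X → Dec (CertIn c X)
  certIn? (cycleCert vs es) X = allFin? λ i → lookup es i ∈? X

  cert⇒CycleIn : ∀ {c X} → IsCycleCert c → CertIn c X → CycleIn G X
  cert⇒CycleIn {cycleCert {k} vs es} (vs-inj , es-inj , joins) es∈X =
    k , lookup vs , lookup es , vs-inj , es-inj , joins , es∈X

  realisations : List (Σ ℕ λ k → Vec (Fin V) (suc k)) → List (CycleCert V m)
  realisations = concatMap λ (k , vs) →
    map (cycleCert vs) (choices (tabulate λ i →
      filter (λ x → joins? (G x) (lookup vs i) (lookup vs (next i))) (allFin m)))
    where
    choices : ∀ {A : Set} {k} → Vec (List A) k → List (Vec A k)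
    choices []         = [ [] ]
    choices (xs ∷ xss) = cartesianProductWith _∷_ xs (choices xss)

  cyclesAlong : List (Σ ℕ λ k → Vec (Fin V) (suc k)) → List (CycleCert V m)
  cyclesAlong walks = filter isCycleCert? (realisations walks)

  cyclesAlong-CycleIn : ∀ walks {X} → Any (λ c → CertIn c X) (cyclesAlong walks) → CycleIn G X
  cyclesAlong-CycleIn walks c∈X = uncurry cert⇒CycleIn (lookupAny (all-filter isCycleCert? (realisations walks)) c∈X)

-- F₇ minus the point 111 is M(K₄): the vertices 0, 1, 2 carry the unit vectors and the vertex 3 carries 0
k4Potential : Fin 4 → Vec Bool 3
k4Potential = lookup
  ((true ∷ false ∷ false ∷ []) ∷ (false ∷ true ∷ false ∷ []) ∷ (false ∷ false ∷ true ∷ []) ∷ zeroV ∷ [])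

k4Edge : Vec Bool 3 → Fin 4 × Fin 4
k4Edge (false ∷ false ∷ false ∷ []) = # 0 , # 0
k4Edge (true  ∷ false ∷ false ∷ []) = # 0 , # 3
k4Edge (false ∷ true  ∷ false ∷ []) = # 1 , # 3
k4Edge (false ∷ false ∷ true  ∷ []) = # 2 , # 3
k4Edge (true  ∷ true  ∷ false ∷ []) = # 0 , # 1
k4Edge (true  ∷ false ∷ true  ∷ []) = # 0 , # 2
k4Edge (false ∷ true  ∷ true  ∷ []) = # 1 , # 2
k4Edge (true  ∷ true  ∷ true  ∷ []) = # 0 , # 0

k4Edge-potential : ∀ c → c ≢ true ∷ true ∷ true ∷ [] → sumCols k4Potential (incidence (k4Edge c)) ≡ c
k4Edge-potential (false ∷ false ∷ false ∷ []) _ = refl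
k4Edge-potential (true  ∷ false ∷ false ∷ []) _ = refl
k4Edge-potential (false ∷ true  ∷ false ∷ []) _ = refl
k4Edge-potential (false ∷ false ∷ true  ∷ []) _ = refl
k4Edge-potential (true  ∷ true  ∷ false ∷ []) _ = refl
k4Edge-potential (true  ∷ false ∷ true  ∷ []) _ = refl
k4Edge-potential (false ∷ true  ∷ true  ∷ []) _ = refl
k4Edge-potential (true  ∷ true  ∷ true  ∷ []) c≢111 = contradiction refl c≢111

-- every cycle of a graph on four vertices whose loops all sit at vertex 0 runs along one of these walks
k4Walks : List (Σ ℕ λ k → Vec (Fin 4) (suc k))
k4Walks =
  (0 , # 0 ∷ []) ∷
  (1 , # 0 ∷ # 1 ∷ []) ∷ (1 , # 0 ∷ # 2 ∷ []) ∷ (1 , # 0 ∷ # 3 ∷ []) ∷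
  (1 , # 1 ∷ # 2 ∷ []) ∷ (1 , # 1 ∷ # 3 ∷ []) ∷ (1 , # 2 ∷ # 3 ∷ []) ∷
  (2 , # 0 ∷ # 1 ∷ # 2 ∷ []) ∷ (2 , # 0 ∷ # 1 ∷ # 3 ∷ []) ∷ (2 , # 0 ∷ # 2 ∷ # 3 ∷ []) ∷ (2 , # 1 ∷ # 2 ∷ # 3 ∷ []) ∷
  (3 , # 0 ∷ # 1 ∷ # 2 ∷ # 3 ∷ []) ∷ (3 , # 0 ∷ # 1 ∷ # 3 ∷ # 2 ∷ []) ∷ (3 , # 0 ∷ # 2 ∷ # 1 ∷ # 3 ∷ []) ∷ []

K4Certified : (Fin m → Vec Bool 3) → Set
K4Certified P = ∀ Z → Nonempty Z → sumCols P Z ≡ zeroV →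
  Any (λ c → CertIn (k4Edge ∘ P) c Z) (cyclesAlong (k4Edge ∘ P) k4Walks)

k4Certified? : (P : Fin m → Vec Bool 3) → Dec (K4Certified P)
k4Certified? P = allSubsets? λ Z → nonempty? Z →-dec
  (sumCols P Z ≟ᵛ zeroV →-dec any? (λ c → certIn? G c Z) (cyclesAlong G k4Walks))
  where G = k4Edge ∘ P

Graphic-K4 : (P : Fin m → Vec Bool 3) → (∀ x → P x ≢ true ∷ true ∷ true ∷ []) → K4Certified P → Graphic (LinIndep P)
Graphic-K4 P avoids certified = Graphic-LinIndep P (k4Edge ∘ P) k4Potential (λ x → k4Edge-potential (P x) (avoids x))
  λ Z Z≢∅ ΣZ≡0 → cyclesAlong-CycleIn (k4Edge ∘ P) k4Walks (certified Z Z≢∅ ΣZ≡0)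

module CycleMatroidCerts {V : ℕ} (G : Fin m → Fin V × Fin V) (walks : List (Σ ℕ λ k → Vec (Fin V) (suc k))) where

  private
    Cyclic : Subset m → Set
    Cyclic X = Any (λ c → CertIn G c X) (cyclesAlong G walks)

    ∪⁅⁆-⊆ : ∀ {X Y : Subset m} {x} → X ⊆ Y → x ∈ Y → X ∪ ⁅ x ⁆ ⊆ Y
    ∪⁅⁆-⊆ {X} {x = x} X⊆Y x∈Y y∈ with x∈p∪q⁻ X ⁅ x ⁆ y∈
    ... | inj₁ y∈X = X⊆Y y∈X
    ... | inj₂ y∈x = subst (_∈ _) (sym (x∈⁅y⁆⇒x≡y x y∈x)) x∈Y

  IsSpanningTreeCert : Subset m → Set
  IsSpanningTreeCert T = LinIndep (incidence ∘ G) T × (∀ x → x ∉ T → Cyclic (T ∪ ⁅ x ⁆))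

  isSpanningTreeCert? : Decidable IsSpanningTreeCert
  isSpanningTreeCert? T = linIndep? T ×-dec allFin? λ x → ¬? (x ∈? T) →-dec any? (λ c → certIn? G c (T ∪ ⁅ x ⁆)) _

  spanningTreeCert⇒IsBasis : ∀ {T} → IsSpanningTreeCert T → IsBasis (CycleMatroid G) T
  spanningTreeCert⇒IsBasis (indep , closes) =
    (λ cycle → cycle⇒¬LinIndep-incidence G cycle indep) ,
    λ { Y (T⊆Y , x , x∈Y , x∉T) acyclic →
        acyclic (CycleIn-mono G (∪⁅⁆-⊆ T⊆Y x∈Y) (cyclesAlong-CycleIn G walks (closes x x∉T))) }

  -- every spanning tree B disjoint from D is refuted: either B is cyclic or B ∪ {j} is still acyclic
  IsCodependentCert : Fin m → Subset m → Set
  IsCodependentCert j D = ∀ B → D ∩ B ≡ Subset.⊥ → Cyclic B ⊎ LinIndep (incidence ∘ G) (B ∪ ⁅ j ⁆)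

  isCodependentCert? : ∀ j → Decidable (IsCodependentCert j)
  isCodependentCert? j D = allSubsets? λ B → D ∩ B ≟ᵛ Subset.⊥ →-dec
    (any? (λ c → certIn? G c B) _ ⊎-dec linIndep? (B ∪ ⁅ j ⁆))

  codependentCert⇒¬Dual : ∀ {j D} → j ∈ D → IsCodependentCert j D → ¬ Dual (CycleMatroid G) D
  codependentCert⇒¬Dual {j} {D} j∈D codependent (B , (acyclic , maximal) , D∩B≡⊥) with codependent B D∩B≡⊥
  ... | inj₁ cyclic = acyclic (cyclesAlong-CycleIn G walks cyclic)
  ... | inj₂ indep  = maximal (B ∪ ⁅ j ⁆) (p⊆p∪q _ , j , q⊆p∪q B _ (x∈⁅x⁆ j) , j∉B)
                        (λ cycle → cycle⇒¬LinIndep-incidence G cycle indep)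
    where
    j∉B : j ∉ B
    j∉B j∈B = ∉⊥ (subst (j ∈_) D∩B≡⊥ (x∈p∩q⁺ (j∈D , j∈B)))

  module WithTrees (trees : List (Subset m)) (trees-spanning : All IsSpanningTreeCert trees) where

    CoindependentCert : Subset m → Set
    CoindependentCert X = Any (λ T → X ∩ T ≡ Subset.⊥) trees

    coindependentCert⇒Dual : ∀ {X} → CoindependentCert X → Dual (CycleMatroid G) X
    coindependentCert⇒Dual X∩T≡⊥ with lookupAny trees-spanning X∩T≡⊥
    ... | spanning , disjoint = _ , spanningTreeCert⇒IsBasis spanning , disjoint

    IsCocircuitCert : Fin m → Subset m → Set
    IsCocircuitCert j D = j ∈ D × IsCodependentCert j D × (∀ Z → Z ⊆ D → Z ≡ D ⊎ CoindependentCert Z)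

    isCocircuitCert? : ∀ j → Decidable (IsCocircuitCert j)
    isCocircuitCert? j D = j ∈? D ×-dec isCodependentCert? j D ×-dec
      allSubsetsOf? D (λ Z → Z ≟ᵛ D ⊎-dec any? (λ T → Z ∩ T ≟ᵛ Subset.⊥) trees)

    cocircuitCert⇒IsCircuit : ∀ {j D} → IsCocircuitCert j D → IsCircuit (Dual (CycleMatroid G)) D
    cocircuitCert⇒IsCircuit (j∈D , codependent , proper) =
      codependentCert⇒¬Dual j∈D codependent ,
      λ { Z (Z⊆D , x , x∈D , x∉Z) → case proper Z Z⊆D of λ
          { (inj₁ refl)        → contradiction x∈D x∉Z
          ; (inj₂ disjointTree) → coindependentCert⇒Dual disjointTree } }

setOf : List (Fin n) → Subset n
setOf = Subset.⋃ ∘ map ⁅_⁆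

-- all cycles of K₃,₃: nine of length four and six of length six
k33Walks : List (Σ ℕ λ k → Vec (Fin 6) (suc k))
k33Walks =
  (3 , # 0 ∷ # 3 ∷ # 1 ∷ # 4 ∷ []) ∷ (3 , # 0 ∷ # 3 ∷ # 1 ∷ # 5 ∷ []) ∷ (3 , # 0 ∷ # 4 ∷ # 1 ∷ # 5 ∷ []) ∷
  (3 , # 0 ∷ # 3 ∷ # 2 ∷ # 4 ∷ []) ∷ (3 , # 0 ∷ # 3 ∷ # 2 ∷ # 5 ∷ []) ∷ (3 , # 0 ∷ # 4 ∷ # 2 ∷ # 5 ∷ []) ∷
  (3 , # 1 ∷ # 3 ∷ # 2 ∷ # 4 ∷ []) ∷ (3 , # 1 ∷ # 3 ∷ # 2 ∷ # 5 ∷ []) ∷ (3 , # 1 ∷ # 4 ∷ # 2 ∷ # 5 ∷ []) ∷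
  (5 , # 0 ∷ # 3 ∷ # 1 ∷ # 4 ∷ # 2 ∷ # 5 ∷ []) ∷ (5 , # 0 ∷ # 3 ∷ # 1 ∷ # 5 ∷ # 2 ∷ # 4 ∷ []) ∷
  (5 , # 0 ∷ # 4 ∷ # 1 ∷ # 3 ∷ # 2 ∷ # 5 ∷ []) ∷ (5 , # 0 ∷ # 4 ∷ # 1 ∷ # 5 ∷ # 2 ∷ # 3 ∷ []) ∷
  (5 , # 0 ∷ # 5 ∷ # 1 ∷ # 3 ∷ # 2 ∷ # 4 ∷ []) ∷ (5 , # 0 ∷ # 5 ∷ # 1 ∷ # 4 ∷ # 2 ∷ # 3 ∷ []) ∷ []

open CycleMatroidCerts K33 k33Walks

-- every set below that has to be shown coindependent in M*(K₃,₃) avoids one of these spanning trees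
k33Trees : List (Subset 9)
k33Trees = map setOf
  ((# 2 ∷ # 5 ∷ # 6 ∷ # 7 ∷ # 8 ∷ []) ∷ (# 0 ∷ # 3 ∷ # 4 ∷ # 5 ∷ # 6 ∷ []) ∷ (# 1 ∷ # 2 ∷ # 3 ∷ # 6 ∷ # 8 ∷ []) ∷
   (# 0 ∷ # 1 ∷ # 2 ∷ # 4 ∷ # 8 ∷ []) ∷ (# 1 ∷ # 3 ∷ # 4 ∷ # 7 ∷ # 8 ∷ []) ∷ (# 0 ∷ # 2 ∷ # 5 ∷ # 6 ∷ # 7 ∷ []) ∷
   (# 1 ∷ # 2 ∷ # 5 ∷ # 6 ∷ # 7 ∷ []) ∷ (# 2 ∷ # 4 ∷ # 5 ∷ # 6 ∷ # 7 ∷ []) ∷ (# 2 ∷ # 3 ∷ # 5 ∷ # 6 ∷ # 7 ∷ []) ∷ [])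

k33Trees-spanning : All IsSpanningTreeCert k33Trees
k33Trees-spanning = from-yes (all? isSpanningTreeCert? k33Trees)

open WithTrees k33Trees k33Trees-spanning

basis : Fin 4 → Fin 9
basis = lookup (# 0 ∷ # 1 ∷ # 3 ∷ # 4 ∷ [])

onBasis : Subset 4 → Subset 9
onBasis = sumCols (⁅_⁆ ∘ basis)

-- the coordinates of each element of M*(K₃,₃) with respect to the basis {0, 1, 3, 4}
coordinates : Fin 9 → Subset 4
coordinates = setOf ∘ lookup
  ((# 0 ∷ []) ∷ (# 1 ∷ []) ∷ (# 0 ∷ # 1 ∷ []) ∷ (# 2 ∷ []) ∷ (# 3 ∷ []) ∷ (# 2 ∷ # 3 ∷ []) ∷
   (# 0 ∷ # 2 ∷ []) ∷ (# 1 ∷ # 3 ∷ []) ∷ (# 0 ∷ # 1 ∷ # 2 ∷ # 3 ∷ []) ∷ [])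

fundamentalCircuit : Fin 9 → Subset 9
fundamentalCircuit j = ⁅ j ⁆ ⊕ onBasis (coordinates j)

basis-coindependent : CoindependentCert (onBasis ⊤)
basis-coindependent = from-yes (any? (λ T → onBasis ⊤ ∩ T ≟ᵛ Subset.⊥) k33Trees)

fundamentalCircuit-cert : ∀ j → fundamentalCircuit j ≡ Subset.⊥ ⊎ IsCocircuitCert j (fundamentalCircuit j)
fundamentalCircuit-cert = from-yes (allFin? λ j →
  fundamentalCircuit j ≟ᵛ Subset.⊥ ⊎-dec isCocircuitCert? j (fundamentalCircuit j))

onBasis-⊆ : ∀ w → onBasis w ⊆ onBasis ⊤
onBasis-⊆ = from-yes (allSubsets? λ w → onBasis w ⊆? onBasis ⊤)

onBasis-Nonempty : ∀ w → Nonempty w → Nonempty (onBasis w)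
onBasis-Nonempty = from-yes (allSubsets? λ w → nonempty? w →-dec nonempty? (onBasis w))

module StandardRepresentation {r} (C : Fin 9 → Vec Bool r) (represents : ∀ Y → MK33* Y ⇔ LinIndep C Y) where

  sumCols-onBasis : ∀ w → sumCols C (onBasis w) ≡ sumCols (C ∘ basis) w
  sumCols-onBasis w = trans (sumCols-sumCols C (⁅_⁆ ∘ basis) w) (sumCols-cong (sumCols-⁅⁆ C ∘ basis) w)

  column-coordinates : ∀ j → C j ≡ sumCols (C ∘ basis) (coordinates j)
  column-coordinates j = ⊕≡zero⇒≡ _ _ (begin
    C j ⊕ sumCols (C ∘ basis) (coordinates j)
      ≡⟨ cong₂ _⊕_ (sumCols-⁅⁆ C j) (sumCols-onBasis (coordinates j)) ⟨
    sumCols C ⁅ j ⁆ ⊕ sumCols C (onBasis (coordinates j))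
      ≡⟨ sumCols-⊕ C ⁅ j ⁆ _ ⟨
    sumCols C (fundamentalCircuit j)
      ≡⟨ sumCols-fundamentalCircuit (fundamentalCircuit-cert j) ⟩
    zeroV ∎)
    where
    open ≡-Reasoning
    sumCols-fundamentalCircuit : ∀ {D} → D ≡ Subset.⊥ ⊎ IsCocircuitCert j D → sumCols C D ≡ zeroV
    sumCols-fundamentalCircuit (inj₁ refl)     = sumCols-⊥ C
    sumCols-fundamentalCircuit (inj₂ circuit) =
      circuit-sumCols C (IsCircuit-cong represents (cocircuitCert⇒IsCircuit circuit))

  basis-injective : ∀ w → sumCols (C ∘ basis) w ≡ zeroV → w ≡ zeroV
  basis-injective w Σw≡0 with nonempty? w
  ... | no w≡∅  = Empty-unique w≡∅
  ... | yes w≢∅ = contradiction (trans (sumCols-onBasis w) Σw≡0)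
    (Equivalence.to (represents _) (coindependentCert⇒Dual basis-coindependent)
      _ (onBasis-⊆ w) (onBasis-Nonempty w w≢∅))

-- a linear map GF(2)⁴ → GF(2)³ with kernel {0, v}, chosen so that no column of M*(K₃,₃) is sent to 111
-- (the value at v = 0 is junk)
quotient : Subset 4 → Fin 4 → Vec Bool 3
quotient (false ∷ false ∷ false ∷ false ∷ []) = λ _ → zeroV
quotient (false ∷ false ∷ false ∷ true ∷ []) =
  lookup ((false ∷ true ∷ false ∷ []) ∷ (false ∷ true ∷ true ∷ []) ∷
          (true ∷ false ∷ false ∷ []) ∷ (false ∷ false ∷ false ∷ []) ∷ [])
quotient (false ∷ false ∷ true ∷ false ∷ []) =
  lookup ((false ∷ true ∷ true ∷ []) ∷ (false ∷ true ∷ false ∷ []) ∷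
          (false ∷ false ∷ false ∷ []) ∷ (true ∷ false ∷ false ∷ []) ∷ [])
quotient (false ∷ false ∷ true ∷ true ∷ []) =
  lookup ((false ∷ false ∷ true ∷ []) ∷ (false ∷ true ∷ false ∷ []) ∷
          (true ∷ false ∷ false ∷ []) ∷ (true ∷ false ∷ false ∷ []) ∷ [])
quotient (false ∷ true ∷ false ∷ false ∷ []) =
  lookup ((false ∷ true ∷ true ∷ []) ∷ (false ∷ false ∷ false ∷ []) ∷
          (false ∷ true ∷ false ∷ []) ∷ (true ∷ false ∷ false ∷ []) ∷ [])
quotient (false ∷ true ∷ false ∷ true ∷ []) =
  lookup ((false ∷ false ∷ true ∷ []) ∷ (true ∷ false ∷ false ∷ []) ∷
          (false ∷ true ∷ false ∷ []) ∷ (true ∷ false ∷ false ∷ []) ∷ [])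
quotient (false ∷ true ∷ true ∷ false ∷ []) =
  lookup ((false ∷ false ∷ true ∷ []) ∷ (false ∷ true ∷ false ∷ []) ∷
          (false ∷ true ∷ false ∷ []) ∷ (true ∷ false ∷ false ∷ []) ∷ [])
quotient (false ∷ true ∷ true ∷ true ∷ []) =
  lookup ((false ∷ true ∷ true ∷ []) ∷ (true ∷ true ∷ false ∷ []) ∷
          (false ∷ true ∷ false ∷ []) ∷ (true ∷ false ∷ false ∷ []) ∷ [])
quotient (true ∷ false ∷ false ∷ false ∷ []) =
  lookup ((false ∷ false ∷ false ∷ []) ∷ (true ∷ false ∷ true ∷ []) ∷
          (false ∷ true ∷ false ∷ []) ∷ (true ∷ false ∷ false ∷ []) ∷ [])
quotient (true ∷ false ∷ false ∷ true ∷ []) =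
  lookup ((true ∷ false ∷ false ∷ []) ∷ (false ∷ false ∷ true ∷ []) ∷
          (false ∷ true ∷ false ∷ []) ∷ (true ∷ false ∷ false ∷ []) ∷ [])
quotient (true ∷ false ∷ true ∷ false ∷ []) =
  lookup ((false ∷ true ∷ false ∷ []) ∷ (false ∷ false ∷ true ∷ []) ∷
          (false ∷ true ∷ false ∷ []) ∷ (true ∷ false ∷ false ∷ []) ∷ [])
quotient (true ∷ false ∷ true ∷ true ∷ []) =
  lookup ((true ∷ true ∷ false ∷ []) ∷ (true ∷ false ∷ true ∷ []) ∷
          (false ∷ true ∷ false ∷ []) ∷ (true ∷ false ∷ false ∷ []) ∷ [])
quotient (true ∷ true ∷ false ∷ false ∷ []) =
  lookup ((false ∷ false ∷ true ∷ []) ∷ (false ∷ false ∷ true ∷ []) ∷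
          (false ∷ true ∷ false ∷ []) ∷ (true ∷ false ∷ false ∷ []) ∷ [])
quotient (true ∷ true ∷ false ∷ true ∷ []) =
  lookup ((false ∷ false ∷ true ∷ []) ∷ (true ∷ false ∷ true ∷ []) ∷
          (false ∷ true ∷ false ∷ []) ∷ (true ∷ false ∷ false ∷ []) ∷ [])
quotient (true ∷ true ∷ true ∷ false ∷ []) =
  lookup ((false ∷ true ∷ true ∷ []) ∷ (false ∷ false ∷ true ∷ []) ∷
          (false ∷ true ∷ false ∷ []) ∷ (true ∷ false ∷ false ∷ []) ∷ [])
quotient (true ∷ true ∷ true ∷ true ∷ []) =
  lookup ((false ∷ true ∷ true ∷ []) ∷ (true ∷ false ∷ true ∷ []) ∷
          (false ∷ true ∷ false ∷ []) ∷ (true ∷ false ∷ false ∷ []) ∷ [])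

private
  nonzero : {P : Subset 4 → Set} → (∀ v → v ≡ zeroV ⊎ P v) → ∀ v → v ≢ zeroV → P v
  nonzero zero-or-P v v≢0 = [ (λ v≡0 → contradiction v≡0 v≢0) , id ]′ (zero-or-P v)

quotient-kills : ∀ v → sumCols (quotient v) v ≡ zeroV
quotient-kills = from-yes (allSubsets? λ v → sumCols (quotient v) v ≟ᵛ zeroV)

quotient-kernel : ∀ v → v ≢ zeroV → ∀ u → sumCols (quotient v) u ≡ zeroV → u ≡ zeroV ⊎ u ≡ v
quotient-kernel = nonzero (from-yes (allSubsets? λ v → v ≟ᵛ zeroV ⊎-dec
  allSubsets? λ u → sumCols (quotient v) u ≟ᵛ zeroV →-dec (u ≟ᵛ zeroV ⊎-dec u ≟ᵛ v)))

quotient-avoids : ∀ v → v ≢ zeroV → ∀ j → sumCols (quotient v) (coordinates j) ≢ true ∷ true ∷ true ∷ []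
quotient-avoids = nonzero (from-yes (allSubsets? λ v → v ≟ᵛ zeroV ⊎-dec
  allFin? λ j → ¬? (sumCols (quotient v) (coordinates j) ≟ᵛ true ∷ true ∷ true ∷ [])))

quotient-certified : ∀ v → v ≢ zeroV → K4Certified (sumCols (quotient v) ∘ coordinates)
quotient-certified = nonzero (from-yes (allSubsets? λ v →
  v ≟ᵛ zeroV ⊎-dec k4Certified? (sumCols (quotient v) ∘ coordinates)))

module Contraction {n r} {N : IndepSys (suc n)} {a : Fin (suc n)} (matroid : IsMatroid N)
                   {A : Fin (suc n) → Vec Bool r} (represents : ∀ X → N X ⇔ LinIndep A X)
                   (¬loop : ¬ Loop N a) (¬coloop : ¬ Coloop N a)
                   {σ : Fin n ↔ Fin 9} (deletion≅ : ∀ Y → MK33* Y ⇔ Delete N a (pullback σ Y)) where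
  open Inverse σ

  C : Fin 9 → Vec Bool r
  C = A ∘ punchIn a ∘ from

  C-represents : ∀ Y → MK33* Y ⇔ LinIndep C Y
  C-represents Y = begin
    MK33* Y                                        ≈⟨ deletion≅ Y ⟩
    N (insertAt (pullback σ Y) a false)            ≈⟨ represents _ ⟩
    LinIndep A (insertAt (pullback σ Y) a false)   ≈⟨ LinIndep-insertAt-outside A a _ ⟩
    LinIndep (A ∘ punchIn a) (pullback σ Y)        ≈⟨ LinIndep-pullback (A ∘ punchIn a) σ Y ⟩
    LinIndep C Y                                   ∎
    where open ⇔-Reasoning

  open StandardRepresentation C C-represents

  L : Subset 4 → Vec Bool r
  L = sumCols (C ∘ basis)

  column-punchIn : ∀ i → A (punchIn a i) ≡ L (coordinates (to i))
  column-punchIn i = trans (cong (A ∘ punchIn a) (sym (strictlyInverseʳ i))) (column-coordinates (to i))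

  v : Subset 4
  v = sumCols (coordinates ∘ to) (proj₁ (noncoloop-column∈span represents a ¬coloop))

  column-a : A a ≡ L v
  column-a with noncoloop-column∈span represents a ¬coloop
  ... | Z , ΣZ≡A-a = begin
    A a                                   ≡⟨ ΣZ≡A-a ⟨
    sumCols (A ∘ punchIn a) Z             ≡⟨ sumCols-cong column-punchIn Z ⟩
    sumCols (L ∘ coordinates ∘ to) Z      ≡⟨ sumCols-sumCols (C ∘ basis) (coordinates ∘ to) Z ⟨
    L (sumCols (coordinates ∘ to) Z)      ∎
    where open ≡-Reasoning

  v≢0 : v ≢ zeroV
  v≢0 v≡0 = nonloop-column≢0 represents a ¬loop (trans column-a (trans (cong L v≡0) (sumCols-⊥ (C ∘ basis))))

  coords : Fin (suc n) → Subset 4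
  coords = lookup (insertAt (tabulate (coordinates ∘ to)) a v)

  coords-a : coords a ≡ v
  coords-a = insertAt-lookup _ a v

  coords-punchIn : ∀ i → coords (punchIn a i) ≡ coordinates (to i)
  coords-punchIn i = trans (insertAt-punchIn _ a v i) (lookup∘tabulate _ i)

  column≡L∘coords : ∀ x → A x ≡ L (coords x)
  column≡L∘coords x with punchInView a x
  ... | at        = trans column-a (cong L (sym coords-a))
  ... | punched i = trans (column-punchIn i) (cong L (sym (coords-punchIn i)))

  P : Fin 9 → Vec Bool 3
  P = sumCols (quotient v) ∘ coordinates

  contraction≅ : ∀ X → Contract N a X ⇔ LinIndep (P ∘ to) X
  contraction≅ X = begin
    Contract N a X                                         ≈⟨ Contract-nonloop matroid ¬loop X ⟩
    N (insertAt X a true)                                  ≈⟨ represents _ ⟩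
    LinIndep A (insertAt X a true)                         ≈⟨ LinIndep-cong column≡L∘coords _ ⟩
    LinIndep (L ∘ coords) (insertAt X a true)                  ≈⟨ LinIndep-sumCols (C ∘ basis) basis-injective coords _ ⟩
    LinIndep coords (insertAt X a true)                        ≈⟨ LinIndep-insertAt-inside coords a (quotient v) coords-a≢0 kills kernel X ⟩
    LinIndep (sumCols (quotient v) ∘ coords ∘ punchIn a) X     ≈⟨ LinIndep-cong (cong (sumCols (quotient v)) ∘ coords-punchIn) X ⟩
    LinIndep (P ∘ to) X                                    ∎
    where
    open ⇔-Reasoning
    coords-a≢0 : coords a ≢ zeroV
    coords-a≢0 = v≢0 ∘ trans (sym coords-a)
    kills : sumCols (quotient v) (coords a) ≡ zeroV
    kills = trans (cong (sumCols (quotient v)) coords-a) (quotient-kills v)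
    kernel : ∀ u → sumCols (quotient v) u ≡ zeroV → u ≡ zeroV ⊎ u ≡ coords a
    kernel u = map₂ (λ u≡v → trans u≡v (sym coords-a)) ∘ quotient-kernel v v≢0 u

  graphic : Graphic (Contract N a)
  graphic = Graphic-Iso (↔-sym σ , λ X → begin
      Contract N a X                    ≈⟨ contraction≅ X ⟩
      LinIndep (P ∘ to) X               ≈⟨ LinIndep-pullback P (↔-sym σ) X ⟨
      LinIndep P (pullback (↔-sym σ) X) ∎)
    (Graphic-K4 P (quotient-avoids v v≢0) (quotient-certified v v≢0))
    where open ⇔-Reasoning

lemma2p13 : ∀ {n} (N : IndepSys (suc n)) (a : Fin (suc n)) →
    IsMatroid N → Binary N →
    ¬ Loop N a → ¬ Coloop N a →
    Iso (Delete N a) MK33* →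
    ¬ Minor F7 (Contract N a) → ¬ Minor F7* (Contract N a) →
    Graphic (Contract N a)
lemma2p13 N a matroid (_ , _ , represents) ¬loop ¬coloop (σ , deletion≅) _ _ =
  Contraction.graphic {a = a} matroid represents ¬loop ¬coloop {σ = σ} deletion≅
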